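{- Let $(u,v)$ be a Hofstadter G pair and let $\beta=\langle\beta_1\ldots\beta_\ell\rangle$ be any Fibonacci representation of $v$. Then $u=\mathrm{FibSum}(\langle\beta_2\ldots\beta_\ell\rangle)+\beta_1$, i.e. $u=\sum_{i=1}^{\ell}\beta_iF_i$.
   Context: $F_0=0$, $F_1=1$, $F_i=F_{i-1}+F_{i-2}$ are the Fibonacci numbers and $\phi=(1+\sqrt5)/2$. For a bit string $\beta=\langle\beta_1\ldots\beta_\ell\rangle$ ($\beta_i\in\{0,1\}$), $\mathrm{FibSum}(\beta)=\sum_{i=1}^\ell\beta_iF_{i+1}$; $\beta$ is a Fibonacci representation of $n$ if $\mathrm{FibSum}(\beta)=n$. Hofstadter's G function is $G(x)=\lfloor\phi^{ -1}(x+1)\rfloor$ for integers $x\ge0$. A Hofstadter G pair is a pair $(u,v)$ of positive integers with $u=G(v)$. -}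

module Defs where

open import Data.Nat using (ℕ; zero; suc; _+_; _*_; _≤_; _<_)
open import Data.Bool using (Bool; true; false)
open import Data.List using (List; []; _∷_)
open import Data.Product using (_×_)
open import Relation.Binary.PropositionalEquality using (_≡_)

F : ℕ → ℕ
F zero = 0
F (suc zero) = 1
F (suc (suc n)) = F (suc n) + F n

bit : Bool → ℕ
bit true = 1
bit false = 0

weightedFib : ℕ → List Bool → ℕ
weightedFib k [] = 0
weightedFib k (b ∷ bs) = bit b * F k + weightedFib (suc k) bs

-- FibSum(β) = Σ_{i=1}^{ℓ} β_i F_{i+1}   (β_1 is the head of the list)
FibSum : List Bool → ℕ
FibSum β = weightedFib 2 β

IsFibRep : List Bool → ℕ → Set
IsFibRep β n = FibSum β ≡ n

-- IsGValue x u  :⇔  u = ⌊ φ⁻¹ (x+1) ⌋, i.e.  u ≤ φ⁻¹(x+1) < u+1.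
-- With φ⁻¹ = (√5 − 1)/2 and m = x+1 these two real inequalities are
-- exactly equivalent to the integer inequalities
--   u ≤ (√5 m − m)/2    ⇔ (2u + m)² ≤ 5 m²
--   (√5 m − m)/2 < u+1  ⇔ 5 m² < (2u + 2 + m)²
IsGValue : ℕ → ℕ → Set
IsGValue x u =
  ((2 * u + (x + 1)) * (2 * u + (x + 1)) ≤ 5 * ((x + 1) * (x + 1)))
  × (5 * ((x + 1) * (x + 1)) < (2 * u + 2 + (x + 1)) * (2 * u + 2 + (x + 1)))

HofGPair : ℕ → ℕ → Set
HofGPair u v = (0 < u) × (0 < v) × IsGValue v u

{-# OPTIONS --safe #-}
-- Write a = Σ βᵢ F_{i-1} and b = Σ βᵢ F_i, so that FibSum β = a + b and the
-- claim is G(a + b) = b.  Prepending a bit c to β maps (a , b) to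
-- (b , a + b + c), under which the norm N(a , b) = b² − ab − a² becomes
-- c (2a + b + c) − N(a , b).  Hence the bounds a − 2b ≤ N(a , b) ≤ 2a + b
-- hold for every β by induction, and multiplied by 4 they imply the two
-- inequalities characterising b = ⌊φ⁻¹ (a + b + 1)⌋, which determine b.
module Submission where

open import Defs
open import Data.Nat using (ℕ; suc; _+_; _*_; _≤_; _<_; z≤n; s≤s)
open import Data.Nat.Properties
open import Data.Nat.Tactic.RingSolver using (solve; solve-∀)
open import Data.Bool using (Bool; true; false)
open import Data.List using (List; []; _∷_)
open import Data.Product using (_×_; _,_)
open import Relation.Binary.PropositionalEquality using (_≡_; refl)

weightedFib-shift : ∀ k β → weightedFib (2 + k) β ≡ weightedFib (1 + k) β + weightedFib k β
weightedFib-shift k [] = refl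
weightedFib-shift k (c ∷ β) rewrite weightedFib-shift (suc k) β =
  distrib (bit c) (F (suc k)) (F k) (weightedFib (2 + k) β) (weightedFib (1 + k) β)
  where
  distrib : ∀ x p q r s → x * (p + q) + (r + s) ≡ x * p + r + (x * q + s)
  distrib = solve-∀

-- l − r = k (p − q) − s, stated without subtraction.
≤-by-offset : ∀ {l r p q} k s → p ≤ q → l + k * q + s ≡ r + k * p → l ≤ r
≤-by-offset {l} {r} {p} {q} k s p≤q eq = +-cancelʳ-≤ (k * q) l r (begin
  l + k * q     ≤⟨ m≤m+n (l + k * q) s ⟩
  l + k * q + s ≡⟨ eq ⟩
  r + k * p     ≤⟨ +-monoʳ-≤ r (*-monoʳ-≤ k p≤q) ⟩
  r + k * q     ∎)
  where open ≤-Reasoning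

-- a − 2b ≤ N(a , b) ≤ 2a + b, cleared of subtraction.
NormBounds : ℕ → ℕ → Set
NormBounds a b = (b * b ≤ a * a + a * b + 2 * a + b)
               × (a * a + a * b + a < suc b * suc b)

NormBounds-cons : ∀ c {a b} → NormBounds a b → NormBounds b (bit c + (b + a))
NormBounds-cons false {a} {b} (upper , lower) =
    ≤-by-offset 1 (b + 2 * a) lower (solve (a ∷ b ∷ []))
  , ≤-by-offset 1 0 upper (solve (a ∷ b ∷ []))
NormBounds-cons true {a} {b} (upper , lower) =
    ≤-by-offset 1 0 lower (solve (a ∷ b ∷ []))
  , ≤-by-offset 1 (2 * a + b + 3) upper (solve (a ∷ b ∷ []))

weightedFib-NormBounds : ∀ β → NormBounds (weightedFib 0 β) (weightedFib 1 β)
weightedFib-NormBounds []          = z≤n , s≤s z≤n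
weightedFib-NormBounds (false ∷ β) rewrite weightedFib-shift 0 β =
  NormBounds-cons false {weightedFib 0 β} (weightedFib-NormBounds β)
weightedFib-NormBounds (true ∷ β)  rewrite weightedFib-shift 0 β =
  NormBounds-cons true {weightedFib 0 β} (weightedFib-NormBounds β)

NormBounds⇒IsGValue : ∀ {a b} → NormBounds a b → IsGValue (b + a) b
NormBounds⇒IsGValue {a} {b} (upper , lower) =
    ≤-by-offset 4 4 upper (solve (a ∷ b ∷ []))
  , ≤-by-offset 4 3 lower (solve (a ∷ b ∷ []))

IsGValue-FibSum : ∀ β → IsGValue (FibSum β) (weightedFib 1 β)
IsGValue-FibSum β rewrite weightedFib-shift 0 β =
  NormBounds⇒IsGValue {weightedFib 0 β} (weightedFib-NormBounds β)

IsGValue-≤ : ∀ {x u w} → IsGValue x u → IsGValue x w → u ≤ w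
IsGValue-≤ {x} {u} {w} (u-upper , _) (_ , w-lower) = ≮⇒≥ λ w<u → <-irrefl refl (begin-strict
  5 * (m * m)                       <⟨ w-lower ⟩
  (2 * w + 2 + m) * (2 * w + 2 + m) ≤⟨ *-mono-≤ (shifted-≤ w<u) (shifted-≤ w<u) ⟩
  (2 * u + m) * (2 * u + m)         ≤⟨ u-upper ⟩
  5 * (m * m)                       ∎)
  where
  open ≤-Reasoning
  m : ℕ
  m = x + 1
  shifted-≤ : w < u → 2 * w + 2 + m ≤ 2 * u + m
  shifted-≤ w<u = +-monoˡ-≤ m (begin
    2 * w + 2 ≡⟨ +-comm (2 * w) 2 ⟩
    2 + 2 * w ≡⟨ *-suc 2 w ⟨
    2 * suc w ≤⟨ *-monoʳ-≤ 2 w<u ⟩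
    2 * u     ∎)

IsGValue-unique : ∀ {x u w} → IsGValue x u → IsGValue x w → u ≡ w
IsGValue-unique Gu Gw = ≤-antisym (IsGValue-≤ Gu Gw) (IsGValue-≤ Gw Gu)

lemma3 : (u v : ℕ) → HofGPair u v → (β : List Bool) → IsFibRep β v →
    u ≡ weightedFib 1 β
lemma3 u v (_ , _ , G[v]≡u) β refl = IsGValue-unique G[v]≡u (IsGValue-FibSum β)
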